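{- Let $G$ be a graph on $n$ vertices which is the complement of a $c$-closed graph, and let $\ell\ge 0$, $k\ge 1$ be integers. The number of sets $S\subseteq V(G)$ for which $G[S]$ admits a good $(\ell,k)$-partition is at most $n^{\ell+2k}\cdot 2^{k(c-1)}$.
   Context: Graphs are finite, simple and undirected. A graph $H$ is $c$-closed if any two non-adjacent vertices have at most $c-1$ common neighbors; $G$ is the complement of a $c$-closed graph iff for any two adjacent vertices $u,v$ of $G$ at most $c-1$ vertices of $G$ are adjacent to neither $u$ nor $v$ (excluding $u,v$). For an edge $e=ab$ of $H$, $N_H(e) = (N_H(a)\cup N_H(b))\setminus\{a,b\}$. A graph $H$ admits a good $(\ell,k)$-partition if there exist $k$ edges $e_1,\dots,e_k$ of $H$ and a partition $\{A_0,A_1,\dots,A_k\}$ of $V(H)\setminus(e_1\cup\dots\cup e_k)$ (edges viewed as 2-element vertex sets) such that $N_H(e_i)\cap A_i=\emptyset$ for all $i\in[k]$ and $|A_0|\le \ell$. -}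

module Defs where

open import Data.Nat using (ℕ; zero; suc; _≤_)
open import Data.Bool using (Bool; true; false; not; _∧_; _∨_; if_then_else_)
open import Data.Fin using (Fin; zero; suc; _≟_)
open import Data.Fin.Subset using (Subset)
open import Data.Vec using (lookup)
open import Data.List using (List; length; filter)
open import Data.Bool.ListAction using (any)
open import Data.List using () renaming (allFin to allFinL)
open import Data.Product using (_×_; _,_; proj₁; proj₂; Σ-syntax)
open import Relation.Nullary using (¬_; Dec; yes; no)
open import Relation.Nullary.Decidable using (⌊_⌋)
open import Relation.Binary.PropositionalEquality using (_≡_; _≢_)
open import Data.List.Relation.Unary.All using (All)
open import Data.List.Relation.Unary.Unique.Propositional using (Unique)

record Graph (n : ℕ) : Set where
  field
    adj   : Fin n → Fin n → Bool
    sym   : ∀ u v → adj u v ≡ adj v u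
    irrefl : ∀ v → adj v v ≡ false
open Graph public

_≠ᵇ_ : ∀ {n} → Fin n → Fin n → Bool
u ≠ᵇ v = not ⌊ u ≟ v ⌋

count : ∀ {n} → (Fin n → Bool) → ℕ
count {n} p = length (filter (λ v → p v Data.Bool.≟ true) (allFinL n))

complement : ∀ {n} → Graph n → Graph n
complement {n} G = record
  { adj = λ u v → not (adj G u v) ∧ (u ≠ᵇ v)
  ; sym = symC
  ; irrefl = irrC }
  where
  open import Relation.Binary.PropositionalEquality using (refl; cong₂; cong)
  ≠ᵇ-sym : ∀ (u v : Fin n) → (u ≠ᵇ v) ≡ (v ≠ᵇ u)
  ≠ᵇ-sym u v with u ≟ v | v ≟ u
  ... | yes _ | yes _ = refl
  ... | no _ | no _ = refl
  ... | yes p | no q = Data.Empty.⊥-elim (q (Relation.Binary.PropositionalEquality.sym p))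
    where import Data.Empty
  ... | no p | yes q = Data.Empty.⊥-elim (p (Relation.Binary.PropositionalEquality.sym q))
    where import Data.Empty
  symC : ∀ u v → (not (adj G u v) ∧ (u ≠ᵇ v)) ≡ (not (adj G v u) ∧ (v ≠ᵇ u))
  symC u v = cong₂ _∧_ (cong not (Graph.sym G u v)) (≠ᵇ-sym u v)
  irrC : ∀ v → (not (adj G v v) ∧ (v ≠ᵇ v)) ≡ false
  irrC v with v ≟ v
  ... | yes _ = Data.Bool.Properties.∧-zeroʳ (not (adj G v v))
    where import Data.Bool.Properties
  ... | no q = Data.Empty.⊥-elim (q refl)
    where import Data.Empty

IsCClosed : ∀ {n} → ℕ → Graph n → Set
IsCClosed {n} c H = ∀ (u v : Fin n) → u ≢ v → adj H u v ≡ false →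
  count (λ w → adj H u w ∧ adj H v w) ≤ c Data.Nat.∸ 1

_∈ₛ_ : ∀ {n} → Fin n → Subset n → Set
v ∈ₛ S = lookup S v ≡ true

-- An edge is an ordered pair of endpoints; as vertex sets e and f coincide
-- iff their endpoint sets coincide.
Edge : ℕ → Set
Edge n = Fin n × Fin n

SameEdge : ∀ {n} → Edge n → Edge n → Set
SameEdge (a , b) (a' , b') = (a ≡ a' × b ≡ b') Data.Sum.⊎ (a ≡ b' × b ≡ a')
  where import Data.Sum

onEdges : ∀ {n k} → (Fin k → Edge n) → Fin n → Bool
onEdges {n} {k} e v =
  any (λ i → ⌊ proj₁ (e i) ≟ v ⌋ ∨ ⌊ proj₂ (e i) ≟ v ⌋) (allFinL k)

-- Partition {A₀,…,A_k} of S ∖ (e₁ ∪ … ∪ e_k) given by a block-assignment f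
-- (A_j = {v ∈ S ∖ ⋃eᵢ | f v = j}); blocks may be empty.
-- Condition N_{G[S]}(eᵢ) ∩ Aᵢ = ∅: a vertex of Aᵢ (which is in S and not an
-- endpoint of eᵢ) is adjacent to neither endpoint of eᵢ.
AdmitsGoodPartition : ∀ {n} → Graph n → Subset n → ℕ → ℕ → Set
AdmitsGoodPartition {n} G S ℓ k =
  Σ[ e ∈ (Fin k → Edge n) ]
  Σ[ f ∈ (Fin n → Fin (suc k)) ]
    (∀ i → proj₁ (e i) ∈ₛ S × proj₂ (e i) ∈ₛ S × adj G (proj₁ (e i)) (proj₂ (e i)) ≡ true)
  × (∀ i j → i ≢ j → ¬ SameEdge (e i) (e j))
  × (∀ v i → v ∈ₛ S → onEdges e v ≡ false → f v ≡ suc i →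
       adj G (proj₁ (e i)) v ≡ false × adj G (proj₂ (e i)) v ≡ false)
  × count (λ v → lookup S v ∧ not (onEdges e v) ∧ ⌊ f v ≟ zero ⌋) ≤ ℓ

module Submission where

-- Fix a good partition of G[S] with edges eᵢ = aᵢbᵢ. A vertex of S outside A₀ and off the edges lies
-- in some Aᵢ, so it is adjacent in G to neither aᵢ nor bᵢ, i.e. it is a common neighbour of the
-- non-adjacent pair aᵢ, bᵢ in the c-closed complement; there are at most c − 1 of those. Hence S is
-- determined by A₀ (at most ℓ vertices), the k edges, and for each edge which of its at most c − 1
-- common non-neighbours lie in S, which leaves at most n^ℓ · (n²)^k · (2^(c−1))^k possibilities.

open import Defs hiding (sym)
open import Data.Nat using (ℕ; _≤_; _*_; _+_; _^_; _∸_; zero; suc; z≤n; s≤s)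
open import Data.Fin.Subset using (Subset)
open import Data.List using (List; length)
open import Data.List.Relation.Unary.All using (All)
open import Data.List.Relation.Unary.Unique.Propositional using (Unique)

open import Data.Nat.Properties
  using (^-distribˡ-+-*; ^-*-assoc; *-comm; *-assoc; *-identityʳ; [m*n]*[o*p]≡[m*o]*[n*p])
open import Data.Bool using (Bool; true; false; T; not; _∧_; _∨_)
import Data.Bool as Bool
open import Data.Bool.Properties using (T-≡; T-∨)
open import Data.Fin using (Fin; combine; _≟_)
import Data.Fin as Fin
open import Data.Fin.Properties using (combine-injective; injective⇒≤; *↔×; 2↔Bool)
open import Data.Vec using (Vec; lookup; tabulate; padRight; fromList; replicate)
import Data.Vec as Vec
open import Data.Vec.Properties using (tabulate∘lookup; tabulate-cong)
open import Data.Vec.Membership.Propositional using () renaming (_∈_ to _∈ᵥ_)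
open import Data.Vec.Membership.Propositional.Properties using (∈-fromList⁺; ∈-fromList⁻)
open import Data.Vec.Relation.Unary.Any as VecAny using (here; there)
import Data.Vec.Relation.Unary.Any.Properties as VecAny
import Data.Vec.Relation.Unary.All as VecAll
import Data.Vec.Relation.Unary.All.Properties as VecAll
import Data.Vec.Membership.DecPropositional as VecMembership
open import Data.List as List using (filter)
open import Data.List.Membership.Propositional using (_∈_; lose)
open import Data.List.Membership.Propositional.Properties using (∈-filter⁺; ∈-filter⁻; ∈-allFin; ∈-lookup)
import Data.List.Membership.DecPropositional as ListMembership
import Data.List.Relation.Unary.Any as ListAny
open import Data.List.Relation.Unary.Any.Properties using (any⁺; any⁻)
import Data.List.Relation.Unary.All as All
open import Data.List.Relation.Unary.AllPairs using (_∷_)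
open import Data.Product using (_×_; _,_; proj₁; proj₂; ∃-syntax)
open import Data.Product.Function.NonDependent.Propositional using (_×-↣_)
open import Data.Sum using (_⊎_; inj₁; inj₂)
import Data.Sum as Sum
open import Data.Empty using (⊥-elim)
open import Relation.Nullary using (¬_; yes; no; does)
open import Relation.Nullary.Decidable using (⌊_⌋; _⊎-dec_; toWitness; fromWitness)
open import Relation.Unary using (Pred; Decidable)
open import Relation.Binary.PropositionalEquality
open import Function using (_∘_; case_of_; _⇔_; mk⇔; Injection; _↣_; mk↣)
open import Function.Bundles using (Equivalence)
open import Function.Construct.Composition using (_↣-∘_)
open import Function.Properties.Injection using (↣-refl)
open import Function.Properties.Inverse using (↔-sym; ↔⇒↣)

private
  variable
    A B : Set
    a b n m ℓ k : ℕ

Vec↣Fin : A ↣ Fin a → Vec A m ↣ Fin (a ^ m)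
Vec↣Fin {A} {a} f = mk↣ injective
  where
  open Injection f using (to) renaming (injective to to-injective)

  encode : ∀ {m} → Vec A m → Fin (a ^ m)
  encode Vec.[]       = Fin.zero
  encode (x Vec.∷ xs) = combine (to x) (encode xs)

  injective : ∀ {m} {xs ys : Vec A m} → encode xs ≡ encode ys → xs ≡ ys
  injective {xs = Vec.[]}     {Vec.[]}     _  = refl
  injective {xs = x Vec.∷ xs} {y Vec.∷ ys} eq
    with combine-injective (to x) (encode xs) (to y) (encode ys) eq
  ... | x≡y , xs≡ys = cong₂ Vec._∷_ (to-injective x≡y) (injective xs≡ys)

×↣Fin : A ↣ Fin a → B ↣ Fin b → (A × B) ↣ Fin (a * b)
×↣Fin f g = ↔⇒↣ (↔-sym *↔×) ↣-∘ (f ×-↣ g)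

Bool↣Fin : Bool ↣ Fin 2
Bool↣Fin = ↔⇒↣ (↔-sym 2↔Bool)

Unique⇒lookup-injective : ∀ {xs : List A} → Unique xs →
                          ∀ {i j} → List.lookup xs i ≡ List.lookup xs j → i ≡ j
Unique⇒lookup-injective (_    ∷ _)    {Fin.zero}  {Fin.zero}  _  = refl
Unique⇒lookup-injective (x≢xs ∷ _)    {Fin.zero}  {Fin.suc j} eq = ⊥-elim (All.lookup x≢xs (∈-lookup j) eq)
Unique⇒lookup-injective (x≢xs ∷ _)    {Fin.suc i} {Fin.zero}  eq = ⊥-elim (All.lookup x≢xs (∈-lookup i) (sym eq))
Unique⇒lookup-injective (_    ∷ uniq) {Fin.suc i} {Fin.suc j} eq = cong Fin.suc (Unique⇒lookup-injective uniq eq)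

length≤-of-decodable : {C : Set} (encode : C ↣ Fin m) (decode : C → A) {xs : List A} →
                       Unique xs → All (λ x → ∃[ c ] decode c ≡ x) xs → length xs ≤ m
length≤-of-decodable encode decode {xs} uniq decodable = injective⇒≤ {f = Injection.to encode ∘ code} injective
  where
  code : Fin (length xs) → _
  code i = proj₁ (All.lookup decodable (∈-lookup i))

  decode-code : ∀ i → decode (code i) ≡ List.lookup xs i
  decode-code i = proj₂ (All.lookup decodable (∈-lookup i))

  injective : ∀ {i j} → Injection.to encode (code i) ≡ Injection.to encode (code j) → i ≡ j
  injective {i} {j} eq = Unique⇒lookup-injective uniq (begin
    List.lookup xs i      ≡⟨ sym (decode-code i) ⟩
    decode (code i)       ≡⟨ cong decode (Injection.injective encode eq) ⟩
    decode (code j)       ≡⟨ decode-code j ⟩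
    List.lookup xs j      ∎)
    where open ≡-Reasoning

subsetOf : ∀ {p} {P : Pred (Fin n) p} → Decidable P → Subset n
subsetOf P? = tabulate (does ∘ P?)

⇔⇒≡subsetOf : ∀ {p} {P : Pred (Fin n) p} (P? : Decidable P) {S : Subset n} →
               (∀ v → v ∈ₛ S ⇔ P v) → S ≡ subsetOf P?
⇔⇒≡subsetOf P? {S} S⇔P = trans (sym (tabulate∘lookup S)) (tabulate-cong pointwise)
  where
  pointwise : ∀ v → lookup S v ≡ does (P? v)
  pointwise v with lookup S v in v∈S | P? v
  ... | true  | yes _  = refl
  ... | true  | no v∉P = ⊥-elim (v∉P (Equivalence.to (S⇔P v) v∈S))
  ... | false | no _   = refl
  ... | false | yes Pv with () ← trans (sym v∈S) (Equivalence.from (S⇔P v) Pv)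

∈-padRight⁺ : ∀ {x d} (m≤n : m ≤ n) {xs : Vec A m} → x ∈ᵥ xs → x ∈ᵥ padRight m≤n d xs
∈-padRight⁺ (s≤s m≤n) (here x≡y)  = here x≡y
∈-padRight⁺ (s≤s m≤n) (there x∈xs) = there (∈-padRight⁺ m≤n x∈xs)

∈-padRight⁻ : ∀ {x d} (m≤n : m ≤ n) {xs : Vec A m} → x ∈ᵥ padRight m≤n d xs → x ≡ d ⊎ x ∈ᵥ xs
∈-padRight⁻ z≤n                   x∈ds         = inj₁ (∈-replicate⁻ x∈ds)
  where
  ∈-replicate⁻ : ∀ {x d k} → x ∈ᵥ replicate k d → x ≡ d
  ∈-replicate⁻ (here x≡d)   = x≡d
  ∈-replicate⁻ (there x∈ds) = ∈-replicate⁻ x∈ds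
∈-padRight⁻ (s≤s m≤n) {_ Vec.∷ _} (here x≡y)   = inj₂ (here x≡y)
∈-padRight⁻ (s≤s m≤n) {_ Vec.∷ _} (there x∈ys) = Sum.map₂ there (∈-padRight⁻ m≤n x∈ys)

select : List A → Vec Bool m → List A
select List.[]       _                 = List.[]
select (_ List.∷ _)  Vec.[]            = List.[]
select (w List.∷ ws) (true  Vec.∷ bits) = w List.∷ select ws bits
select (w List.∷ ws) (false Vec.∷ bits) = select ws bits

bitsOf : ∀ {p} {P : Pred A p} → Decidable P → List A → Vec Bool m
bitsOf {m = m}     P? List.[]       = replicate m false
bitsOf {m = zero}  P? (_ List.∷ _)  = Vec.[]
bitsOf {m = suc m} P? (w List.∷ ws) = does (P? w) Vec.∷ bitsOf P? ws

select-bitsOf : ∀ {p} {P : Pred A p} (P? : Decidable P) {ws : List A} → length ws ≤ m →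
                select ws (bitsOf {m = m} P? ws) ≡ filter P? ws
select-bitsOf P? {List.[]}       _         = refl
select-bitsOf {m = suc m} P? {w List.∷ ws} (s≤s |ws|≤m) with does (P? w)
... | true  = cong (w List.∷_) (select-bitsOf P? {ws} |ws|≤m)
... | false = select-bitsOf P? {ws} |ws|≤m

commonNonNeighbours : Graph n → Fin n → Fin n → List (Fin n)
commonNonNeighbours {n} G a b =
  filter (λ w → (adj (complement G) a w ∧ adj (complement G) b w) Bool.≟ true) (List.allFin n)

length-commonNonNeighbours≤ : ∀ {c} {G : Graph n} → IsCClosed c (complement G) →
                              ∀ {a b} → adj G a b ≡ true → length (commonNonNeighbours G a b) ≤ c ∸ 1
length-commonNonNeighbours≤ {G = G} closed {a} {b} ab = closed a b a≢b (cong (λ x → not x ∧ (a ≠ᵇ b)) ab)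
  where
  a≢b : a ≢ b
  a≢b refl with () ← trans (sym ab) (irrefl G a)

∈-commonNonNeighbours : ∀ {G : Graph n} {a b v} → a ≢ v → b ≢ v →
                        adj G a v ≡ false → adj G b v ≡ false → v ∈ commonNonNeighbours G a b
∈-commonNonNeighbours {G = G} {v = v} a≢v b≢v av bv =
  ∈-filter⁺ _ (∈-allFin v) (cong₂ _∧_ (nonAdjacent a≢v av) (nonAdjacent b≢v bv))
  where
  nonAdjacent : ∀ {u} → u ≢ v → adj G u v ≡ false → adj (complement G) u v ≡ true
  nonAdjacent {u} u≢v uv rewrite uv with u ≟ v
  ... | yes u≡v = ⊥-elim (u≢v u≡v)
  ... | no _    = refl

module _ {k} (e : Fin k → Edge n) (v : Fin n) where

  IsEndpoint : Fin k → Set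
  IsEndpoint i = proj₁ (e i) ≡ v ⊎ proj₂ (e i) ≡ v

  T-isEndpoint : ∀ i → T (⌊ proj₁ (e i) ≟ v ⌋ ∨ ⌊ proj₂ (e i) ≟ v ⌋) ⇔ IsEndpoint i
  T-isEndpoint i = mk⇔
    (Sum.map (toWitness {a? = proj₁ (e i) ≟ v}) (toWitness {a? = proj₂ (e i) ≟ v}) ∘ Equivalence.to T-∨)
    (Equivalence.from T-∨ ∘ Sum.map (fromWitness {a? = proj₁ (e i) ≟ v}) (fromWitness {a? = proj₂ (e i) ≟ v}))

  onEdges-true : onEdges e v ≡ true → ∃[ i ] IsEndpoint i
  onEdges-true on with ListAny.satisfied (any⁻ _ (List.allFin k) (Equivalence.from T-≡ on))
  ... | i , endpoint = i , Equivalence.to (T-isEndpoint i) endpoint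

  onEdges-false : onEdges e v ≡ false → ∀ i → ¬ IsEndpoint i
  onEdges-false off i endpoint = case trans (sym off) on of λ ()
    where
    on : onEdges e v ≡ true
    on = Equivalence.to T-≡ (any⁺ _ (lose (∈-allFin i) (Equivalence.from (T-isEndpoint i) endpoint)))

Entry : ℕ → ℕ → Set
Entry n m = Edge n × Vec Bool m

Code : ℕ → ℕ → ℕ → ℕ → Set
Code n ℓ k m = Vec (Fin n) ℓ × Vec (Entry n m) k

module Decoding (G : Graph n) where

  Covers : Entry n m → Fin n → Set
  Covers ((a , b) , bits) v = v ≡ a ⊎ v ≡ b ⊎ v ∈ select (commonNonNeighbours G a b) bits

  Listed : Code n ℓ k m → Fin n → Set
  Listed (xs , entries) v = v ∈ᵥ xs ⊎ VecAny.Any (λ entry → Covers entry v) entries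

  covers? : (entry : Entry n m) → Decidable (Covers entry)
  covers? ((a , b) , bits) v =
    (v ≟ a) ⊎-dec (v ≟ b) ⊎-dec (v ∈? select (commonNonNeighbours G a b) bits)
    where open ListMembership _≟_

  listed? : (code : Code n ℓ k m) → Decidable (Listed code)
  listed? (xs , entries) v = (v ∈? xs) ⊎-dec VecAny.any? (λ entry → covers? entry v) entries
    where open VecMembership _≟_

  decode : Code n ℓ k m → Subset n
  decode code = subsetOf (listed? code)

^-distribʳ-* : ∀ a b k → (a * b) ^ k ≡ a ^ k * b ^ k
^-distribʳ-* a b zero    = refl
^-distribʳ-* a b (suc k) =
  trans (cong (a * b *_) (^-distribʳ-* a b k)) ([m*n]*[o*p]≡[m*o]*[n*p] a b (a ^ k) (b ^ k))

Code↣Fin : Code n ℓ k m ↣ Fin (n ^ ℓ * ((n * n) * 2 ^ m) ^ k)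
Code↣Fin = ×↣Fin (Vec↣Fin ↣-refl) (Vec↣Fin (×↣Fin (×↣Fin ↣-refl ↣-refl) (Vec↣Fin Bool↣Fin)))

codeCount : ∀ n ℓ k m → n ^ ℓ * ((n * n) * 2 ^ m) ^ k ≡ n ^ (ℓ + 2 * k) * 2 ^ (k * m)
codeCount n ℓ k m = begin
  n ^ ℓ * ((n * n) * 2 ^ m) ^ k           ≡⟨ cong (n ^ ℓ *_) (^-distribʳ-* (n * n) (2 ^ m) k) ⟩
  n ^ ℓ * ((n * n) ^ k * (2 ^ m) ^ k)     ≡⟨ cong₂ (λ x y → n ^ ℓ * (x * y)) [n*n]^k (2^m^k) ⟩
  n ^ ℓ * (n ^ (2 * k) * 2 ^ (k * m))     ≡⟨ *-assoc (n ^ ℓ) _ _ ⟨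
  n ^ ℓ * n ^ (2 * k) * 2 ^ (k * m)       ≡⟨ cong (_* 2 ^ (k * m)) (^-distribˡ-+-* n ℓ (2 * k)) ⟨
  n ^ (ℓ + 2 * k) * 2 ^ (k * m)           ∎
  where
  open ≡-Reasoning
  [n*n]^k : (n * n) ^ k ≡ n ^ (2 * k)
  [n*n]^k = trans (cong (λ x → (n * x) ^ k) (sym (*-identityʳ n))) (^-*-assoc n 2 k)
  2^m^k : (2 ^ m) ^ k ≡ 2 ^ (k * m)
  2^m^k = trans (^-*-assoc 2 m k) (cong (2 ^_) (*-comm m k))

module GoodPartitionCode {c ℓ k} (G : Graph n) (closed : IsCClosed c (complement G))
                         {S : Subset n} (good : AdmitsGoodPartition G S ℓ (suc k)) where

  open Decoding G

  e : Fin (suc k) → Edge n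
  e = proj₁ good

  f : Fin n → Fin (suc (suc k))
  f = proj₁ (proj₂ good)

  endpoints∈S : ∀ i → proj₁ (e i) ∈ₛ S × proj₂ (e i) ∈ₛ S × adj G (proj₁ (e i)) (proj₂ (e i)) ≡ true
  endpoints∈S = proj₁ (proj₂ (proj₂ good))

  nonAdjacent : ∀ v i → v ∈ₛ S → onEdges e v ≡ false → f v ≡ Fin.suc i →
                adj G (proj₁ (e i)) v ≡ false × adj G (proj₂ (e i)) v ≡ false
  nonAdjacent = proj₁ (proj₂ (proj₂ (proj₂ (proj₂ good))))

  inA₀ : Fin n → Bool
  inA₀ v = lookup S v ∧ not (onEdges e v) ∧ ⌊ f v ≟ Fin.zero ⌋

  A₀ : List (Fin n)
  A₀ = filter (λ v → inA₀ v Bool.≟ true) (List.allFin n)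

  |A₀|≤ℓ : length A₀ ≤ ℓ
  |A₀|≤ℓ = proj₂ (proj₂ (proj₂ (proj₂ (proj₂ good))))

  _∈S? : Decidable (_∈ₛ S)
  v ∈S? = lookup S v Bool.≟ true

  entry : Fin (suc k) → Entry n (c ∸ 1)
  entry i = e i , bitsOf _∈S? (commonNonNeighbours G (proj₁ (e i)) (proj₂ (e i)))

  -- Padding A₀ with an endpoint of the first edge lists no vertex outside S; this is where 1 ≤ k is used.
  code : Code n ℓ (suc k) (c ∸ 1)
  code = padRight |A₀|≤ℓ (proj₁ (e Fin.zero)) (fromList A₀) , tabulate entry

  selected≡ : ∀ i → let (a , b) = e i in
              select (commonNonNeighbours G a b) (proj₂ (entry i)) ≡ filter _∈S? (commonNonNeighbours G a b)
  selected≡ i = select-bitsOf _∈S? {commonNonNeighbours G (proj₁ (e i)) (proj₂ (e i))}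
                  (length-commonNonNeighbours≤ {c = c} {G = G} closed (proj₂ (proj₂ (endpoints∈S i))))

  CoversOnlyS : Entry n (c ∸ 1) → Set
  CoversOnlyS x = ∀ {v} → Covers x v → v ∈ₛ S

  covered⇒∈ : ∀ i → CoversOnlyS (entry i)
  covered⇒∈ i (inj₁ refl)        = proj₁ (endpoints∈S i)
  covered⇒∈ i (inj₂ (inj₁ refl)) = proj₁ (proj₂ (endpoints∈S i))
  covered⇒∈ i (inj₂ (inj₂ v∈sel)) =
    proj₂ (∈-filter⁻ _∈S? {xs = commonNonNeighbours G _ _} (subst (_∈_ _) (selected≡ i) v∈sel))

  A₀⊆S : ∀ {v} → v ∈ A₀ → v ∈ₛ S
  A₀⊆S {v} v∈A₀ with lookup S v | proj₂ (∈-filter⁻ _ {xs = List.allFin n} v∈A₀)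
  ... | true | _ = refl

  listed⇒∈ : ∀ {v} → Listed code v → v ∈ₛ S
  listed⇒∈ (inj₁ v∈xs) with ∈-padRight⁻ |A₀|≤ℓ v∈xs
  ... | inj₁ refl = proj₁ (endpoints∈S Fin.zero)
  ... | inj₂ v∈A₀ = A₀⊆S (∈-fromList⁻ v∈A₀)
  listed⇒∈ (inj₂ covered) with VecAll.lookupAny (VecAll.tabulate⁺ {P = CoversOnlyS} covered⇒∈) covered
  ... | sound , covers = sound covers

  ∈⇒listed : ∀ {v} → v ∈ₛ S → Listed code v
  ∈⇒listed {v} v∈S with onEdges e v in onE
  ... | true with onEdges-true e v onE
  ...   | i , endpoint = inj₂ (VecAny.tabulate⁺ {f = entry} i (Sum.map sym (inj₁ ∘ sym) endpoint))
  ∈⇒listed {v} v∈S | false with f v in fv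
  ... | Fin.zero  = inj₁ (∈-padRight⁺ |A₀|≤ℓ (∈-fromList⁺ (∈-filter⁺ _ (∈-allFin v) v∈A₀)))
    where
    v∈A₀ : inA₀ v ≡ true
    v∈A₀ rewrite v∈S | onE | fv = refl
  ... | Fin.suc i = inj₂ (VecAny.tabulate⁺ {f = entry} i (inj₂ (inj₂ v∈selected)))
    where
    notEndpoint : ¬ IsEndpoint e v i
    notEndpoint = onEdges-false e v onE i

    nonAdjacentᵥ : adj G (proj₁ (e i)) v ≡ false × adj G (proj₂ (e i)) v ≡ false
    nonAdjacentᵥ = nonAdjacent v i v∈S onE fv

    v∈selected : v ∈ select (commonNonNeighbours G (proj₁ (e i)) (proj₂ (e i))) (proj₂ (entry i))
    v∈selected = subst (_∈_ v) (sym (selected≡ i))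
      (∈-filter⁺ _∈S? (∈-commonNonNeighbours {G = G} (notEndpoint ∘ inj₁) (notEndpoint ∘ inj₂)
                                              (proj₁ nonAdjacentᵥ) (proj₂ nonAdjacentᵥ)) v∈S)

  decode-code : decode code ≡ S
  decode-code = sym (⇔⇒≡subsetOf (listed? code) (λ v → mk⇔ ∈⇒listed listed⇒∈))

lemma13 : (n c ℓ k : ℕ) → 1 ≤ c → 1 ≤ k → (G : Graph n) →
    IsCClosed c (complement G) →
    (Ss : List (Subset n)) → Unique Ss → All (λ S → AdmitsGoodPartition G S ℓ k) Ss →
    length Ss ≤ n ^ (ℓ + 2 * k) * 2 ^ (k * (c ∸ 1))
lemma13 n c ℓ zero    _ ()
lemma13 n c ℓ (suc k) _ _ G closed Ss uniq goods =
  subst (length Ss ≤_) (codeCount n ℓ (suc k) (c ∸ 1))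
    (length≤-of-decodable Code↣Fin (Decoding.decode G) uniq (All.map decodable goods))
  where
  decodable : ∀ {S} → AdmitsGoodPartition G S ℓ (suc k) →
              ∃[ code ] Decoding.decode G code ≡ S
  decodable {S} good = code , decode-code
    where open GoodPartitionCode {c = c} {ℓ = ℓ} {k = k} G closed {S} good
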